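{- Let $F\colon\mathbf{Set}\to\mathbf{Set}$ be a functor preserving weak pullbacks that has a separating set of monotone predicate liftings, and let $\alpha\colon X\to FX$ be a coalgebra with $X$ finite. Let $R_n, T, I$ be the output of the partition refinement algorithm described in the context. Let $(x_0,x_1)\notin R_n$; then $I(x_0,x_1)<\infty$ and $T(x_0,x_1)$ is defined. Consider the following strategy of the spoiler $S$ at any position $(y_0,y_1)\notin R_n$: (i) If $T(y_0,y_1)=(y_j,P)$, then in Step 1 $S$ plays $j\in\{0,1\}$ and the predicate $p_j=\chi_P$. (ii) Suppose in Step 2 the duplicator $D$ answers with a predicate $p_{1-j}$ such that $Fp_j(\alpha(y_j))\le^F Fp_{1-j}(\alpha(y_{1-j}))$. Then there exists a state $y'_{1-j}\in X$ with $p_{1-j}(y'_{1-j})=1$ and $I(y'_j,y'_{1-j})<I(y_0,y_1)$ for all $y'_j\in X$ with $p_j(y'_j)=1$; in Step 3 $S$ chooses $\ell=1-j$ and such a state $y'_{1-j}$. (iii) Then whatever state $y'_j$ with $p_j(y'_j)=1$ the duplicator selects in Step 4, the game continues with a position $(y'_0,y'_1)$ satisfying $(y'_0,y'_1)\notin R_n$ and $I(y'_0,y'_1)<I(y_0,y_1)$. In particular, the existence claim in (ii) always holds, and this strategy is a winning strategy for the spoiler from the initial position $(x_0,x_1)$.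
   Context: For a set $Y$ with a preorder $\le\subseteq Y\times Y$, the lifted preorder $\le^F$ on $FY$ is defined by $t_0\le^F t_1$ iff there is $t\in F(\le)$ with $F\pi_i(t)=t_i$ for $i\in\{0,1\}$, where $\pi_0,\pi_1\colon{\le}\to Y$ are the projections. We use $2=\{0,1\}$ with $0\le 1$ and the resulting order $\le^F$ on $F2$. An evaluation map is a function $\lambda\colon F2\to 2$; it induces the predicate lifting sending $p\colon X\to 2$ to $\lambda\circ Fp\colon FX\to 2$; it is monotone if $\lambda$ is monotone w.r.t. $\le^F$ and $\le$. A set $\Lambda$ of evaluation maps is separating if for every set $X$ and all $t_0\neq t_1$ in $FX$ there are $\lambda\in\Lambda$ and $p\colon X\to 2$ with $\lambda(Fp(t_0))\ne\lambda(Fp(t_1))$. For $P\subseteq X$, $\chi_P\colon X\to 2$ is its characteristic function. For an equivalence relation $R$ on $X$, $E(R)$ is its set of equivalence classes. Partition refinement algorithm: initially $I(x,y)=\infty$ for all $(x,y)\in X\times X$, $R_0=X\times X$, $i=0$. Repeat: set $i:=i+1$, $R_i:=R_{i-1}$; for every $(x,y)\in R_{i-1}$ and every $P\in E(R_{i-1})$: if $F\chi_P(\alpha(x))\not\le^F F\chi_P(\alpha(y))$, then set $T(x,y):=(x,P)$, $I(x,y):=i$ and remove $(x,y)$ from $R_i$; else if $F\chi_P(\alpha(y))\not\le^F F\chi_P(\alpha(x))$, then set $T(x,y):=(y,P)$, $I(x,y):=i$ and remove $(x,y)$ from $R_i$. Stop when $R_i=R_{i-1}$; let $R_n$ be the final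 relation. The output is $R_n$, the partial map $T\colon (X\times X)\setminus R_n\to X\times\mathcal P(X)$ and $I\colon X\times X\to\mathbb N_0\cup\{\infty\}$. Bisimulation game on $\alpha$ from a position $(x_0,x_1)\in X\times X$: Step 1: $S$ chooses $j\in\{0,1\}$ and a predicate $p_j\colon X\to 2$. Step 2: $D$ must respond with a predicate $p_{1-j}\colon X\to2$ such that $Fp_j(\alpha(x_j))\le^F Fp_{1-j}(\alpha(x_{1-j}))$. Step 3: $S$ chooses $\ell\in\{0,1\}$ and $x'_\ell\in X$ with $p_\ell(x'_\ell)=1$. Step 4: $D$ must respond with $x'_{1-\ell}\in X$ with $p_{1-\ell}(x'_{1-\ell})=1$. The game then continues from $(x'_0,x'_1)$. $D$ wins if the game continues forever or $S$ has no move in Step 3; $S$ wins if $D$ has no move in Step 2 or Step 4. -}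

module Defs where

open import Data.Bool using (Bool; true; false; not; _≤_)
open import Data.Nat using (ℕ; zero; suc; _<_)
open import Data.Product using (Σ; _×_; _,_; proj₁; proj₂)
open import Data.Maybe using (Maybe; just; nothing)
open import Data.Sum using (_⊎_)
open import Data.Unit using (⊤)
open import Data.Empty using (⊥)
open import Relation.Binary.PropositionalEquality using (_≡_; _≢_)
open import Relation.Nullary using (¬_)

-- Since Agda has no function extensionality, the action on morphisms is
-- required to respect pointwise equality, and the functor laws are stated
-- pointwise.

record SetFunctor : Set₁ where
  field
    F₀       : Set → Set
    fmap     : ∀ {A B : Set} → (A → B) → F₀ A → F₀ B
    fmap-cong : ∀ {A B : Set} {f g : A → B} → (∀ a → f a ≡ g a) →
                ∀ t → fmap f t ≡ fmap g t
    fmap-id  : ∀ {A : Set} (t : F₀ A) → fmap (λ a → a) t ≡ t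
    fmap-∘   : ∀ {A B C : Set} (f : A → B) (g : B → C) (t : F₀ A) →
               fmap (λ a → g (f a)) t ≡ fmap g (fmap f t)

open SetFunctor

IsWeakPullback : {A B C P : Set} (f : A → C) (g : B → C)
                 (p₁ : P → A) (p₂ : P → B) → Set₁
IsWeakPullback {A} {B} {C} {P} f g p₁ p₂ =
  (∀ z → f (p₁ z) ≡ g (p₂ z)) ×
  (∀ (Q : Set) (q₁ : Q → A) (q₂ : Q → B) → (∀ w → f (q₁ w) ≡ g (q₂ w)) →
     Σ (Q → P) λ h → (∀ w → p₁ (h w) ≡ q₁ w) × (∀ w → p₂ (h w) ≡ q₂ w))

PreservesWeakPullbacks : SetFunctor → Set₁
PreservesWeakPullbacks F =
  ∀ {A B C P : Set} (f : A → C) (g : B → C) (p₁ : P → A) (p₂ : P → B) →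
  IsWeakPullback f g p₁ p₂ →
  IsWeakPullback (fmap F f) (fmap F g) (fmap F p₁) (fmap F p₂)

Graph : {Y : Set} → (Y → Y → Set) → Set
Graph {Y} _≼_ = Σ (Y × Y) λ p → proj₁ p ≼ proj₂ p

LiftedOrder : (F : SetFunctor) {Y : Set} → (Y → Y → Set) →
              F₀ F Y → F₀ F Y → Set
LiftedOrder F _≼_ t₀ t₁ =
  Σ (F₀ F (Graph _≼_)) λ t →
    (fmap F (λ e → proj₁ (proj₁ e)) t ≡ t₀) ×
    (fmap F (λ e → proj₂ (proj₁ e)) t ≡ t₁)

Le2 : (F : SetFunctor) → F₀ F Bool → F₀ F Bool → Set
Le2 F = LiftedOrder F _≤_

MonotoneEval : (F : SetFunctor) → (F₀ F Bool → Bool) → Set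
MonotoneEval F λ' = ∀ t₀ t₁ → Le2 F t₀ t₁ → λ' t₀ ≤ λ' t₁

Separating : (F : SetFunctor) {L : Set} → (L → F₀ F Bool → Bool) → Set₁
Separating F {L} Λ =
  ∀ (X : Set) (t₀ t₁ : F₀ F X) → t₀ ≢ t₁ →
  Σ L λ l → Σ (X → Bool) λ p → Λ l (fmap F p t₀) ≢ Λ l (fmap F p t₁)

HasSeparatingMonotoneLiftings : SetFunctor → Set₁
HasSeparatingMonotoneLiftings F =
  Σ Set λ L → Σ (L → F₀ F Bool → Bool) λ Λ →
    (∀ l → MonotoneEval F (Λ l)) × Separating F Λ

data ℕ∞ : Set where
  fin : ℕ → ℕ∞
  ∞   : ℕ∞

_<∞_ : ℕ∞ → ℕ∞ → Set
fin a <∞ fin b = a < b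
fin _ <∞ ∞     = ⊤
∞     <∞ _     = ⊥

module Refinement (F : SetFunctor) {X : Set} (α : X → F₀ F X) where

  -- F χ_P (α x) ≤^F F χ_P (α y); subsets P ⊆ X are given by χ_P : X → Bool.
  Le : (X → Bool) → X → X → Set
  Le P x y = Le2 F (fmap F P (α x)) (fmap F P (α y))

  -- P ∈ E(R): P is the equivalence class of some x.
  IsClass : (X → X → Set) → (X → Bool) → Set
  IsClass R P = Σ X λ x → ∀ y → (P y ≡ true → R x y) × (R x y → P y ≡ true)

  -- The relations R_i computed by the algorithm:  R_0 = X × X, and
  -- (x,y) stays in R_i iff (x,y) ∈ R_{i-1} and for every P ∈ E(R_{i-1})
  -- neither of the two removal tests fires.
  R : ℕ → X → X → Set
  R zero    x y = ⊤
  R (suc i) x y = R i x y × (∀ P → IsClass (R i) P → Le P x y × Le P y x)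

  Stable : ℕ → Set
  Stable m = ∀ x y → (R (suc m) x y → R m x y) × (R m x y → R (suc m) x y)

  -- The fate of a pair (x,y) in a run of the algorithm that stops with R_n:
  -- either it is never removed (I = ∞, T undefined), or it is removed in
  -- iteration i+1, with I = i+1 and T recording the state and the class
  -- P ∈ E(R_i) that triggered the removal (first test / second test).
  PairOutput : ℕ → ℕ∞ → Maybe (X × (X → Bool)) → X → X → Set
  PairOutput n Ixy Txy x y =
    (R n x y × Ixy ≡ ∞ × Txy ≡ nothing) ⊎
    (Σ ℕ λ i → R i x y × Ixy ≡ fin (suc i) ×
      Σ (X → Bool) λ P → IsClass (R i) P ×
        ((Txy ≡ just (x , P) × ¬ Le P x y) ⊎
         (Txy ≡ just (y , P) × Le P x y × ¬ Le P y x)))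

  record IsOutput (n : ℕ) (I : X → X → ℕ∞)
                  (T : X → X → Maybe (X × (X → Bool))) : Set where
    field
      stops   : Stable n
      minimal : ∀ m → m < n → ¬ Stable m
      pairs   : ∀ x y → PairOutput n (I x y) (T x y) x y

  -- Positions; comp j pos = y_j, and place j a b is the position whose
  -- j-th component is a and whose (1-j)-th component is b.
  comp : Bool → X × X → X
  comp false = proj₁
  comp true  = proj₂

  place : Bool → X → X → X × X
  place false a b = (a , b)
  place true  a b = (b , a)

  Rₚ : ℕ → X × X → Set
  Rₚ i pos = R i (proj₁ pos) (proj₂ pos)

  Iₚ : (X → X → ℕ∞) → X × X → ℕ∞
  Iₚ I pos = I (proj₁ pos) (proj₂ pos)

  Step2OK : Bool → X × X → (X → Bool) → (X → Bool) → Set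
  Step2OK j pos pj q = Le2 F (fmap F pj (α (comp j pos)))
                              (fmap F q (α (comp (not j) pos)))

  GoodChoice : (X → X → ℕ∞) → Bool → X × X → (X → Bool) → (X → Bool) →
               X → Set
  GoodChoice I j pos pj q y' =
    q y' ≡ true × (∀ z → pj z ≡ true → Iₚ I (place j z y') <∞ Iₚ I pos)

  -- The spoiler wins from pos by playing the strategy (i)-(ii):
  -- in Step 1 he plays j and χ_P where T(pos) = (y_j, P); for every legal
  -- answer p_{1-j} of D a good choice y' exists (S has a move in Step 3),
  -- and whichever good choice y' S makes and whatever legal answer y'_j
  -- D makes in Step 4, S again wins from the resulting position.
  -- (Inductive: every play following the strategy ends with D stuck.)
  data StrategyWins (I : X → X → ℕ∞) (T : X → X → Maybe (X × (X → Bool)))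
       : X × X → Set where
    win : ∀ {pos} (j : Bool) (P : X → Bool) →
          T (proj₁ pos) (proj₂ pos) ≡ just (comp j pos , P) →
          (∀ (q : X → Bool) → Step2OK j pos P q →
             (Σ X λ y' → GoodChoice I j pos P q y') ×
             (∀ y' → GoodChoice I j pos P q y' →
                ∀ z → P z ≡ true → StrategyWins I T (place j z y'))) →
          StrategyWins I T pos

module Submission where

-- Write ≤^F for the lifted order on F2 and let (n, I, T) be an
-- output of partition refinement.  Three general facts drive the argument.
--   (a) Lifted orders are monotone in pointwise-ordered maps, and, because F
--       preserves weak pullbacks, the lifting of a transitive relation is
--       transitive.
--   (b) Each R_i is symmetric and transitive, the R_i decrease, and once the
--       sequence is stable at n it stays constant, so R_n ⊆ R_m for every m.
--       Hence a pair in R_n is never removed (I = ∞), and a pair outside R_i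
--       was removed before round i+1 (I < i+1).
--   (c) On a finite set, inclusion of two predicates is decidable.
-- The spoiler's move: if T(y₀,y₁) = (y_j, P) with P ∈ E(R_i), I(y₀,y₁) = i+1,
-- and D answers q, then q ⊄ P, for otherwise (a) would give
-- Fχ_P(α y_j) ≤^F Fq(α y_{1-j}) ≤^F Fχ_P(α y_{1-j}), contradicting the removal
-- test.  So by (c) there is y' with q y' = 1 and y' ∉ P; for every z ∈ P the
-- pair (z, y') is then outside R_i, so its index is < i+1 by (b), and finite
-- indices mean the pair is outside R_n.  Since the index strictly decreases
-- along the play, induction on the index shows the strategy wins.

open import Defs
open import Data.Bool using (Bool; true; false; not; _≤_; b≤b; f≤t)
import Data.Bool.Properties as BoolP
open import Data.Nat using (ℕ; zero; suc; _+_; _∸_; s≤s) renaming (_≤_ to _≤ℕ_)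
import Data.Nat.Properties as NatP
open import Data.Fin using (Fin)
import Data.Fin.Properties as FinP
open import Data.Product using (Σ; _×_; _,_; proj₁; proj₂; ∃; swap)
open import Data.Maybe using (Maybe; just)
open import Data.Sum using (_⊎_; inj₁; inj₂)
open import Data.Unit using (⊤; tt)
open import Function using (_∘_)
open import Function.Bundles using (_↔_; Inverse)
open import Relation.Binary.Core using (_⇒_; _⇔_)
open import Relation.Binary.Definitions using (Transitive)
open import Relation.Binary.PropositionalEquality
open import Relation.Nullary using (¬_; Dec; yes; no; contradiction)
open import Relation.Nullary.Decidable using (map′; _×-dec_)
open import Relation.Unary using (Decidable)
open SetFunctor

module LiftedOrderProperties (F : SetFunctor) {Y : Set} (_≼_ : Y → Y → Set) where

  src tgt : Graph _≼_ → Y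
  src e = proj₁ (proj₁ e)
  tgt e = proj₂ (proj₁ e)

  lifted-pointwise : {Z : Set} (f g : Z → Y) → (∀ z → f z ≼ g z) →
                     ∀ t → LiftedOrder F _≼_ (fmap F f t) (fmap F g t)
  lifted-pointwise f g f≼g t =
    fmap F edge t , sym (fmap-∘ F edge src t) , sym (fmap-∘ F edge tgt t)
    where
      edge : _ → Graph _≼_
      edge z = (f z , g z) , f≼g z

  Path : Set
  Path = Σ (Graph _≼_ × Graph _≼_) λ es → tgt (proj₁ es) ≡ src (proj₂ es)

  first second : Path → Graph _≼_
  first  w = proj₁ (proj₁ w)
  second w = proj₂ (proj₁ w)

  paths-weak-pullback : IsWeakPullback tgt src first second
  paths-weak-pullback =
    proj₂ , λ Q q₁ q₂ commutes →
      (λ w → (q₁ w , q₂ w) , commutes w) , (λ _ → refl) , (λ _ → refl)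

  compose : Transitive _≼_ → Path → Graph _≼_
  compose ≼-trans w =
    (src (first w) , tgt (second w)) ,
    ≼-trans (proj₂ (first w)) (subst (_≼ tgt (second w)) (sym (proj₂ w)) (proj₂ (second w)))

  -- Weak pullback preservation glues two witnesses along their common
  -- middle; composing the glued edges witnesses the composite.
  lifted-trans : PreservesWeakPullbacks F → Transitive _≼_ →
                 Transitive (LiftedOrder F _≼_)
  lifted-trans preserves ≼-trans {a} {b} {c} (t , t-src , t-tgt) (s , s-src , s-tgt) =
    fmap F (compose ≼-trans) u , src-end , tgt-end
    where
      glue = proj₂ (preserves tgt src first second paths-weak-pullback)
                   ⊤ (λ _ → t) (λ _ → s) (λ _ → trans t-tgt (sym s-src))
      u : F₀ F Path
      u = proj₁ glue tt

      open ≡-Reasoning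
      src-end : fmap F src (fmap F (compose ≼-trans) u) ≡ a
      src-end = begin
        fmap F src (fmap F (compose ≼-trans) u) ≡⟨ sym (fmap-∘ F (compose ≼-trans) src u) ⟩
        fmap F (λ w → src (first w)) u          ≡⟨ fmap-∘ F first src u ⟩
        fmap F src (fmap F first u)             ≡⟨ cong (fmap F src) (proj₁ (proj₂ glue) tt) ⟩
        fmap F src t                            ≡⟨ t-src ⟩
        a                                       ∎

      tgt-end : fmap F tgt (fmap F (compose ≼-trans) u) ≡ c
      tgt-end = begin
        fmap F tgt (fmap F (compose ≼-trans) u) ≡⟨ sym (fmap-∘ F (compose ≼-trans) tgt u) ⟩
        fmap F (λ w → tgt (second w)) u         ≡⟨ fmap-∘ F second tgt u ⟩
        fmap F tgt (fmap F second u)            ≡⟨ cong (fmap F tgt) (proj₂ (proj₂ glue) tt) ⟩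
        fmap F tgt s                            ≡⟨ s-tgt ⟩
        c                                       ∎

inclusion⇒≤ : ∀ {a b} → (a ≡ true → b ≡ true) → a ≤ b
inclusion⇒≤ {false} {false} _ = b≤b
inclusion⇒≤ {false} {true}  _ = f≤t
inclusion⇒≤ {true}  {true}  _ = b≤b
inclusion⇒≤ {true}  {false} a⇒b with () ← a⇒b refl

module FiniteSearch {X : Set} (finite : Σ ℕ λ m → X ↔ Fin m) where

  open Inverse (proj₂ finite)

  ∃? : {Q : X → Set} → Decidable Q → Dec (∃ Q)
  ∃? {Q} Q? = map′ (λ (k , q) → from k , q)
                   (λ (x , q) → to x , subst Q (sym (strictlyInverseʳ x)) q)
                   (FinP.any? (Q? ∘ from))

  inclusion-or-counterexample : (q P : X → Bool) →
    (∀ y → q y ≡ true → P y ≡ true) ⊎ (Σ X λ y → q y ≡ true × P y ≡ false)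
  inclusion-or-counterexample q P
    with ∃? (λ y → (q y BoolP.≟ true) ×-dec (P y BoolP.≟ false))
  ... | yes counterexample = inj₂ counterexample
  ... | no  none = inj₁ λ y qy → BoolP.¬-not (λ Py≡false → none (y , qy , Py≡false))

≮∞-zero : ∀ a → ¬ (a <∞ fin 0)
≮∞-zero (fin _) ()
≮∞-zero ∞       ()

<∞-<-suc : ∀ {a b k} → a <∞ b → b <∞ fin (suc k) → a <∞ fin k
<∞-<-suc {fin _} {fin _} a<b (s≤s b≤k) = NatP.≤-trans a<b b≤k

module Coalgebra (F : SetFunctor) (preserves : PreservesWeakPullbacks F)
                 {X : Set} (α : X → F₀ F X) where
  open Refinement F α

  le2-trans : ∀ {a b c} → Le2 F a b → Le2 F b c → Le2 F a c
  le2-trans = LiftedOrderProperties.lifted-trans F _≤_ preserves BoolP.≤-trans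

  le2-inclusion : {Z : Set} (q P : Z → Bool) → (∀ z → q z ≡ true → P z ≡ true) →
                  ∀ t → Le2 F (fmap F q t) (fmap F P t)
  le2-inclusion q P q⊆P =
    LiftedOrderProperties.lifted-pointwise F _≤_ q P (λ z → inclusion⇒≤ (q⊆P z))

  R-sym : ∀ i {x y} → R i x y → R i y x
  R-sym zero    _       = tt
  R-sym (suc i) (r , h) = R-sym i r , λ P c → swap (h P c)

  R-trans : ∀ i {x y w} → R i x y → R i y w → R i x w
  R-trans zero    _       _       = tt
  R-trans (suc i) (r , h) (s , k) = R-trans i r s , λ P c →
    le2-trans (proj₁ (h P c)) (proj₁ (k P c)) , le2-trans (proj₂ (k P c)) (proj₂ (h P c))

  place-related : ∀ i j {z y′} → Rₚ i (place j z y′) → R i z y′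
  place-related i false r = r
  place-related i true  r = R-sym i r

  class-closed : ∀ {S : X → X → Set} {P} → Transitive S → IsClass S P →
                 ∀ {z y} → P z ≡ true → S z y → P y ≡ true
  class-closed S-trans (c , is-class) Pz Szy =
    proj₂ (is-class _) (S-trans (proj₁ (is-class _) Pz) Szy)

  R-drop : ∀ k {i} → R (k + i) ⇒ R i
  R-drop zero    r       = r
  R-drop (suc k) (r , _) = R-drop k r

  R-antitone : ∀ {i m} → i ≤ℕ m → R m ⇒ R i
  R-antitone {i} {m} i≤m {x} {y} r =
    R-drop (m ∸ i) (subst (λ k → R k x y) (sym (NatP.m∸n+n≡m i≤m)) r)

  class-transport : ∀ {S S′ : X → X → Set} → S ⇔ S′ → ∀ {P} → IsClass S P → IsClass S′ P
  class-transport (S⇒S′ , S′⇒S) (c , is-class) =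
    c , λ y → S⇒S′ ∘ proj₁ (is-class y) , proj₂ (is-class y) ∘ S′⇒S

  R-suc-cong : ∀ {a b} → R a ⇔ R b → R (suc a) ⇔ R (suc b)
  R-suc-cong a⇔b =
    (λ (r , h) → proj₁ a⇔b r , λ P c → h P (class-transport (swap a⇔b) c)) ,
    (λ (r , h) → proj₂ a⇔b r , λ P c → h P (class-transport a⇔b c))

  stable-forever : ∀ {n} → Stable n → ∀ k → R (k + n) ⇔ R n
  stable-forever st zero    = (λ r → r) , (λ r → r)
  stable-forever st (suc k) =
    (λ r → proj₁ (st _ _) (proj₁ (R-suc-cong (stable-forever st k)) r)) ,
    (λ r → proj₂ (R-suc-cong (stable-forever st k)) (proj₂ (st _ _) r))

  stable⇒below-all : ∀ {n} → Stable n → ∀ m → R n ⇒ R m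
  stable⇒below-all {n} st m {x} {y} r with NatP.≤-total m n
  ... | inj₁ m≤n = R-antitone m≤n r
  ... | inj₂ n≤m =
    subst (λ k → R k x y) (NatP.m∸n+n≡m n≤m) (proj₂ (stable-forever st (m ∸ n)) r)

  comp-agree : ∀ j′ j (pos : X × X) → comp j′ pos ≡ comp j pos →
               comp (not j′) pos ≡ comp (not j) pos
  comp-agree false false _ _ = refl
  comp-agree true  true  _ _ = refl
  comp-agree false true  _ e = sym e
  comp-agree true  false _ e = sym e

  just-pair-injective : ∀ {a b : X} {P Q : X → Bool} →
    _≡_ {A = Maybe (X × (X → Bool))} (just (a , P)) (just (b , Q)) → a ≡ b × P ≡ Q
  just-pair-injective refl = refl , refl

  same-test : ∀ j′ j (pos : X × X) {P₀ P} →
    _≡_ {A = Maybe (X × (X → Bool))} (just (comp j′ pos , P₀)) (just (comp j pos , P)) →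
    ¬ Le P₀ (comp j′ pos) (comp (not j′) pos) →
    P₀ ≡ P × ¬ Le P (comp j pos) (comp (not j) pos)
  same-test j′ j pos e ¬le with just-pair-injective e
  ... | same-state , refl =
    refl , subst₂ (λ a b → ¬ Le _ a b) same-state (comp-agree j′ j pos same-state) ¬le

  module Output (n : ℕ) (I : X → X → ℕ∞) (T : X → X → Maybe (X × (X → Bool)))
                (output : IsOutput n I T) where
    open IsOutput output

    pair-fate : ∀ x y → (R n x y × I x y ≡ ∞) ⊎
                (Σ ℕ λ i → R i x y × ¬ R (suc i) x y × I x y ≡ fin (suc i))
    pair-fate x y with pairs x y
    ... | inj₁ (r , I≡∞ , _) = inj₁ (r , I≡∞)
    ... | inj₂ (i , r , I≡ , P , c , inj₁ (_ , ¬le)) =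
      inj₂ (i , r , (λ r′ → ¬le (proj₁ (proj₂ r′ P c))) , I≡)
    ... | inj₂ (i , r , I≡ , P , c , inj₂ (_ , _ , ¬le)) =
      inj₂ (i , r , (λ r′ → ¬le (proj₂ (proj₂ r′ P c))) , I≡)

    related⇒never-removed : ∀ {x y} → R n x y → I x y ≡ ∞
    related⇒never-removed {x} {y} r with pair-fate x y
    ... | inj₁ (_ , I≡∞) = I≡∞
    ... | inj₂ (i , _ , ¬r , _) = contradiction (stable⇒below-all stops (suc i) r) ¬r

    index-below⇒unrelated : ∀ {x y b} → I x y <∞ b → ¬ R n x y
    index-below⇒unrelated {b = b} lt r = subst (_<∞ b) (related⇒never-removed r) lt

    below-or-related : ∀ i x y → I x y <∞ fin (suc i) ⊎ R i x y
    below-or-related i x y with pair-fate x y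
    ... | inj₁ (r , _) = inj₂ (stable⇒below-all stops i r)
    ... | inj₂ (i′ , r , _ , I≡) with i′ NatP.<? i
    ...   | yes i′<i = inj₁ (subst (_<∞ fin (suc i)) (sym I≡) (s≤s i′<i))
    ...   | no  i′≮i = inj₂ (R-antitone (NatP.≮⇒≥ i′≮i) r)

    unrelated⇒removed : ∀ {x y} → ¬ R n x y →
      (Σ ℕ λ i → I x y ≡ fin (suc i)) ×
      (Σ Bool λ j → Σ (X → Bool) λ P → T x y ≡ just (comp j (x , y) , P))
    unrelated⇒removed {x} {y} ¬r with pairs x y
    ... | inj₁ (r , _) = contradiction r ¬r
    ... | inj₂ (i , _ , I≡ , P , _ , inj₁ (T≡ , _))     = (i , I≡) , false , P , T≡
    ... | inj₂ (i , _ , I≡ , P , _ , inj₂ (T≡ , _ , _)) = (i , I≡) , true  , P , T≡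

    removal-witness : ∀ {y₀ y₁} j P → T y₀ y₁ ≡ just (comp j (y₀ , y₁) , P) →
      Σ ℕ λ i → IsClass (R i) P × I y₀ y₁ ≡ fin (suc i) ×
                ¬ Le P (comp j (y₀ , y₁)) (comp (not j) (y₀ , y₁))
    removal-witness {y₀} {y₁} j P T≡ with pairs y₀ y₁
    ... | inj₁ (_ , _ , T≡nothing) with () ← trans (sym T≡nothing) T≡
    ... | inj₂ (i , _ , I≡ , P₀ , c , inj₁ (T≡₀ , ¬le))
      with same-test false j _ (trans (sym T≡₀) T≡) ¬le
    ...   | refl , ¬le′ = i , c , I≡ , ¬le′
    removal-witness {y₀} {y₁} j P T≡
      | inj₂ (i , _ , I≡ , P₀ , c , inj₂ (T≡₀ , _ , ¬le))
      with same-test true j _ (trans (sym T≡₀) T≡) ¬le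
    ...   | refl , ¬le′ = i , c , I≡ , ¬le′

    module Spoiler (finite : Σ ℕ λ m → X ↔ Fin m) where
      open FiniteSearch finite

      spoiler-move : ∀ {y₀ y₁} j P → T y₀ y₁ ≡ just (comp j (y₀ , y₁) , P) →
        ∀ q → Step2OK j (y₀ , y₁) P q →
        (Σ X λ y′ → GoodChoice I j (y₀ , y₁) P q y′) ×
        (∀ y′ → GoodChoice I j (y₀ , y₁) P q y′ → ∀ z → P z ≡ true →
           ¬ Rₚ n (place j z y′) × Iₚ I (place j z y′) <∞ I y₀ y₁)
      spoiler-move {y₀} {y₁} j P T≡ q legal with removal-witness j P T≡
      ... | i , P-class , I≡ , ¬le = good-choice (inclusion-or-counterexample q P) , progress
        where
          pos = (y₀ , y₁)

          -- q ⊆ P would make the removal test pass after all.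
          good-choice : _ → Σ X λ y′ → GoodChoice I j pos P q y′
          good-choice (inj₁ q⊆P) =
            contradiction (le2-trans legal (le2-inclusion q P q⊆P (α (comp (not j) pos)))) ¬le
          good-choice (inj₂ (y′ , qy′ , Py′≡false)) = y′ , qy′ , index-drops
            where
              index-drops : ∀ z → P z ≡ true → Iₚ I (place j z y′) <∞ I y₀ y₁
              index-drops z Pz
                with below-or-related i (proj₁ (place j z y′)) (proj₂ (place j z y′))
              ... | inj₁ lt = subst (Iₚ I (place j z y′) <∞_) (sym I≡) lt
              ... | inj₂ r  = contradiction
                (trans (sym Py′≡false) (class-closed (R-trans i) P-class Pz (place-related i j r)))
                λ ()

          progress : ∀ y′ → GoodChoice I j pos P q y′ → ∀ z → P z ≡ true →
                     ¬ Rₚ n (place j z y′) × Iₚ I (place j z y′) <∞ I y₀ y₁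
          progress y′ (_ , index-drops) z Pz =
            index-below⇒unrelated (index-drops z Pz) , index-drops z Pz

      spoiler-wins-below : ∀ k pos → ¬ Rₚ n pos → Iₚ I pos <∞ fin k → StrategyWins I T pos
      spoiler-wins-below zero    pos     _  bound = contradiction bound (≮∞-zero _)
      spoiler-wins-below (suc k) (x , y) ¬r bound with unrelated⇒removed ¬r
      ... | _ , j , P , T≡ = win j P T≡ λ q legal →
        let (choice , progress) = spoiler-move j P T≡ q legal in
        choice , λ y′ good z Pz →
          let (¬r′ , smaller) = progress y′ good z Pz in
          spoiler-wins-below k (place j z y′) ¬r′ (<∞-<-suc smaller bound)

      spoiler-wins : ∀ {x₀ x₁} → ¬ R n x₀ x₁ →
        (Σ ℕ λ k → I x₀ x₁ ≡ fin k) ×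
        (Σ (X × (X → Bool)) λ v → T x₀ x₁ ≡ just v) ×
        StrategyWins I T (x₀ , x₁)
      spoiler-wins ¬r with unrelated⇒removed ¬r
      ... | (i , I≡) , j , P , T≡ =
        (suc i , I≡) , (_ , T≡) ,
        spoiler-wins-below (suc (suc i)) _ ¬r
          (subst (_<∞ fin (suc (suc i))) (sym I≡) (NatP.n<1+n (suc i)))

proposition4 : (F : SetFunctor) → PreservesWeakPullbacks F →
    HasSeparatingMonotoneLiftings F →
    {X : Set} → (Σ ℕ λ m → X ↔ Fin m) → (α : X → SetFunctor.F₀ F X) →
    (n : ℕ) (I : X → X → ℕ∞) (T : X → X → Maybe (X × (X → Bool))) →
    Refinement.IsOutput F α n I T →
    (∀ x₀ x₁ → ¬ Refinement.R F α n x₀ x₁ →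
       (Σ ℕ λ k → I x₀ x₁ ≡ fin k) ×
       (Σ (X × (X → Bool)) λ v → T x₀ x₁ ≡ just v) ×
       Refinement.StrategyWins F α I T (x₀ , x₁)) ×
    (∀ y₀ y₁ → ¬ Refinement.R F α n y₀ y₁ →
       ∀ (j : Bool) (P : X → Bool) →
       T y₀ y₁ ≡ just (Refinement.comp F α j (y₀ , y₁) , P) →
       ∀ (q : X → Bool) → Refinement.Step2OK F α j (y₀ , y₁) P q →
       (Σ X λ y' → Refinement.GoodChoice F α I j (y₀ , y₁) P q y') ×
       (∀ y' → Refinement.GoodChoice F α I j (y₀ , y₁) P q y' →
          ∀ z → P z ≡ true →
          ¬ Refinement.Rₚ F α n (Refinement.place F α j z y') ×
          Refinement.Iₚ F α I (Refinement.place F α j z y') <∞ I y₀ y₁))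
proposition4 F preserves _ finite α n I T output =
  (λ _ _ → spoiler-wins) , λ _ _ _ → spoiler-move
  where open Coalgebra.Output.Spoiler F preserves α n I T output finite
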